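{- For $n\geq 2$ let $\Delta_n=c_{n+1}-c_n$. If $n=2^k m$ with $k\geq 0$ an integer and $m\geq 3$ odd, then $\Delta_n=n$ when $m=3$, and $\Delta_n=n-\frac{m-1}{2}$ when $m>3$. Further, $\Delta_{2^k}=2^k-1$ for every integer $k\geq 1$.
   Context: The sequence $(c_n)_{n\geq 2}$ is defined by $c_2=1$, $c_3=2$, and $c_n=\lfloor \frac{n}{2}\rfloor\lceil \frac{n}{2}\rceil+c_{\lceil n/2\rceil}$ for $n>3$. -}

module Defs where

open import Data.Nat using (ℕ; zero; suc; _+_; _*_; _/_)

⌊_/2⌋ : ℕ → ℕ
⌊ n /2⌋ = n / 2

⌈_/2⌉ : ℕ → ℕ
⌈ n /2⌉ = (n + 1) / 2

-- fuel-based evaluation of the recursion; fuel ≥ n suffices since ⌈n/2⌉ < n for n ≥ 2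
cF : ℕ → ℕ → ℕ
cF zero n = 0
cF (suc f) 0 = 0                -- c₀, c₁ are not part of the sequence (junk values)
cF (suc f) 1 = 0
cF (suc f) 2 = 1
cF (suc f) 3 = 2
cF (suc f) n@(suc (suc (suc (suc _)))) = ⌊ n /2⌋ * ⌈ n /2⌉ + cF f ⌈ n /2⌉

c : ℕ → ℕ
c n = cF n n

{-# OPTIONS --safe #-}
module Submission where

-- Since c₂ₙ = n² + cₙ and c₂ₙ₊₁ = n(n+1) + cₙ₊₁ for n ≥ 2, we get Δ₂ₙ = n + Δₙ,
-- so the deficit n − Δₙ is invariant under doubling. It therefore suffices to
-- compute it at the odd part m of n, where Δ₃ = 3 and Δ₂ₐ₊₁ = a + 1 for a ≥ 2
-- (since c₂ₐ₊₂ − c₂ₐ₊₁ = (a+1)² − a(a+1)), and, for powers of two, at Δ₂ = 1.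

open import Defs
open import Data.Nat using (ℕ; suc; _+_; _*_; _^_; _∸_; _/_; _%_; _≤_; _<_; z≤n; s≤s)
open import Data.Nat.Properties
open import Data.Nat.DivMod using (m≡m%n+[m/n]*n; m*n/n≡m; +-distrib-/-∣ˡ; m<n*o⇒m/o<n)
open import Data.Nat.Divisibility using (m∣m*n)
open import Data.Nat.Tactic.RingSolver using (solve)
open import Data.List using (_∷_; [])
open import Data.Product using (_×_; _,_)
open import Relation.Binary.PropositionalEquality

⌊2n/2⌋≡n : ∀ n → ⌊ 2 * n /2⌋ ≡ n
⌊2n/2⌋≡n n = trans (cong (_/ 2) (*-comm 2 n)) (m*n/n≡m n 2)

[2n+r]/2≡n+r/2 : ∀ n r → (2 * n + r) / 2 ≡ n + r / 2
[2n+r]/2≡n+r/2 n r = trans (+-distrib-/-∣ˡ r (m∣m*n n)) (cong (_+ r / 2) (⌊2n/2⌋≡n n))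

⌈2n/2⌉≡n : ∀ n → ⌈ 2 * n /2⌉ ≡ n
⌈2n/2⌉≡n n = trans ([2n+r]/2≡n+r/2 n 1) (+-identityʳ n)

⌊2n+1/2⌋≡n : ∀ n → ⌊ 2 * n + 1 /2⌋ ≡ n
⌊2n+1/2⌋≡n = ⌈2n/2⌉≡n

⌈2n+1/2⌉≡n+1 : ∀ n → ⌈ 2 * n + 1 /2⌉ ≡ n + 1
⌈2n+1/2⌉≡n+1 n = trans (cong (_/ 2) (+-assoc (2 * n) 1 1)) ([2n+r]/2≡n+r/2 n 2)

2≤n⇒⌈n/2⌉<n : ∀ {n} → 2 ≤ n → ⌈ n /2⌉ < n
2≤n⇒⌈n/2⌉<n {n} 2≤n = m<n*o⇒m/o<n (begin-strict
  n + 1  <⟨ +-monoʳ-< n 2≤n ⟩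
  n + n  ≡⟨ cong (n +_) (+-identityʳ n) ⟨
  2 * n  ≡⟨ *-comm 2 n ⟩
  n * 2  ∎)
  where open ≤-Reasoning

odd⇒≡2[n/2]+1 : ∀ {n} → n % 2 ≡ 1 → n ≡ 2 * (n / 2) + 1
odd⇒≡2[n/2]+1 {n} n%2≡1 = begin
  n                  ≡⟨ m≡m%n+[m/n]*n n 2 ⟩
  n % 2 + n / 2 * 2  ≡⟨ cong (_+ n / 2 * 2) n%2≡1 ⟩
  1 + n / 2 * 2      ≡⟨ +-comm 1 (n / 2 * 2) ⟩
  n / 2 * 2 + 1      ≡⟨ cong (_+ 1) (*-comm (n / 2) 2) ⟩
  2 * (n / 2) + 1    ∎
  where open ≡-Reasoning

cF-fuel-irrelevant : ∀ f g n → n ≤ f → n ≤ g → cF f n ≡ cF g n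
cF-fuel-irrelevant 0       0       0 _ _ = refl
cF-fuel-irrelevant 0       (suc g) 0 _ _ = refl
cF-fuel-irrelevant (suc f) 0       0 _ _ = refl
cF-fuel-irrelevant (suc f) (suc g) 0 _ _ = refl
cF-fuel-irrelevant (suc f) (suc g) 1 _ _ = refl
cF-fuel-irrelevant (suc f) (suc g) 2 _ _ = refl
cF-fuel-irrelevant (suc f) (suc g) 3 _ _ = refl
cF-fuel-irrelevant (suc f) (suc g) n@(suc (suc (suc (suc _)))) n≤1+f n≤1+g =
  cong (⌊ n /2⌋ * ⌈ n /2⌉ +_) (cF-fuel-irrelevant f g ⌈ n /2⌉ (halve n≤1+f) (halve n≤1+g))
  where
  halve : ∀ {h} → n ≤ suc h → ⌈ n /2⌉ ≤ h
  halve n≤1+h = ≤-pred (<-≤-trans (2≤n⇒⌈n/2⌉<n (s≤s (s≤s z≤n))) n≤1+h)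

c-unfold : ∀ {n} → 4 ≤ n → c n ≡ ⌊ n /2⌋ * ⌈ n /2⌉ + c ⌈ n /2⌉
c-unfold {n@(suc n-1)} (s≤s (s≤s (s≤s (s≤s _)))) =
  cong (⌊ n /2⌋ * ⌈ n /2⌉ +_)
    (cF-fuel-irrelevant n-1 ⌈ n /2⌉ ⌈ n /2⌉ (≤-pred (2≤n⇒⌈n/2⌉<n (s≤s (s≤s z≤n)))) ≤-refl)

c-double : ∀ {n} → 2 ≤ n → c (2 * n) ≡ n * n + c n
c-double {n} 2≤n =
  trans (c-unfold (*-monoʳ-≤ 2 2≤n)) (cong₂ (λ a b → a * b + c b) (⌊2n/2⌋≡n n) (⌈2n/2⌉≡n n))

c-double+1 : ∀ {n} → 2 ≤ n → c (2 * n + 1) ≡ n * (n + 1) + c (n + 1)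
c-double+1 {n} 2≤n =
  trans (c-unfold (≤-trans (*-monoʳ-≤ 2 2≤n) (m≤m+n (2 * n) 1)))
        (cong₂ (λ a b → a * b + c b) (⌊2n+1/2⌋≡n n) (⌈2n+1/2⌉≡n+1 n))

-- ΔDeficit n d means Δₙ = n − d.
ΔDeficit : ℕ → ℕ → Set
ΔDeficit n d = c (n + 1) + d ≡ c n + n

ΔDeficit-double : ∀ {n d} → 2 ≤ n → ΔDeficit n d → ΔDeficit (2 * n) d
ΔDeficit-double {n} {d} 2≤n Δₙ = begin
  c (2 * n + 1) + d              ≡⟨ cong (_+ d) (c-double+1 2≤n) ⟩
  n * (n + 1) + c (n + 1) + d    ≡⟨ +-assoc (n * (n + 1)) (c (n + 1)) d ⟩
  n * (n + 1) + (c (n + 1) + d)  ≡⟨ cong (n * (n + 1) +_) Δₙ ⟩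
  n * (n + 1) + (c n + n)        ≡⟨ rearrange (c n) ⟩
  n * n + c n + 2 * n            ≡⟨ cong (_+ 2 * n) (c-double 2≤n) ⟨
  c (2 * n) + 2 * n              ∎
  where
  open ≡-Reasoning
  rearrange : ∀ x → n * (n + 1) + (x + n) ≡ n * n + x + 2 * n
  rearrange x = solve (n ∷ x ∷ [])

ΔDeficit-2^k* : ∀ {m d} → 2 ≤ m → ΔDeficit m d → ∀ k → ΔDeficit (2 ^ k * m) d
ΔDeficit-2^k* {m} {d} _ Δₘ 0 = subst (λ n → ΔDeficit n d) (sym (+-identityʳ m)) Δₘ
ΔDeficit-2^k* {m} {d} 2≤m Δₘ (suc k) =
  subst (λ n → ΔDeficit n d) (sym (*-assoc 2 (2 ^ k) m))
    (ΔDeficit-double (*-mono-≤ (m^n>0 2 k) 2≤m) (ΔDeficit-2^k* 2≤m Δₘ k))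

ΔDeficit-2 : ΔDeficit 2 1
ΔDeficit-2 = refl

ΔDeficit-3 : ΔDeficit 3 0
ΔDeficit-3 = refl

ΔDeficit-2a+1 : ∀ {a} → 2 ≤ a → ΔDeficit (2 * a + 1) a
ΔDeficit-2a+1 {a} 2≤a = begin
  c (2 * a + 1 + 1) + a                  ≡⟨ cong (λ n → c n + a) 2a+1+1≡2[a+1] ⟩
  c (2 * (a + 1)) + a                    ≡⟨ cong (_+ a) (c-double (≤-trans 2≤a (m≤m+n a 1))) ⟩
  (a + 1) * (a + 1) + c (a + 1) + a      ≡⟨ rearrange (c (a + 1)) ⟩
  a * (a + 1) + c (a + 1) + (2 * a + 1)  ≡⟨ cong (_+ (2 * a + 1)) (c-double+1 2≤a) ⟨
  c (2 * a + 1) + (2 * a + 1)            ∎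
  where
  open ≡-Reasoning
  2a+1+1≡2[a+1] : 2 * a + 1 + 1 ≡ 2 * (a + 1)
  2a+1+1≡2[a+1] = trans (+-assoc (2 * a) 1 1) (sym (*-distribˡ-+ 2 a 1))
  rearrange : ∀ x → (a + 1) * (a + 1) + x + a ≡ a * (a + 1) + x + (2 * a + 1)
  rearrange x = solve (a ∷ x ∷ [])

3<2a+1⇒2≤a : ∀ {a} → 3 < 2 * a + 1 → 2 ≤ a
3<2a+1⇒2≤a {0}           (s≤s ())
3<2a+1⇒2≤a {1}           (s≤s (s≤s (s≤s ())))
3<2a+1⇒2≤a {suc (suc a)} _ = s≤s (s≤s z≤n)

ΔDeficit-odd : ∀ {m} → m % 2 ≡ 1 → 3 < m → ΔDeficit m ((m ∸ 1) / 2)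
ΔDeficit-odd {m} m%2≡1 3<m with m / 2 | odd⇒≡2[n/2]+1 {m} m%2≡1
... | a | refl =
  subst (ΔDeficit (2 * a + 1)) (sym [2a+1∸1]/2≡a) (ΔDeficit-2a+1 (3<2a+1⇒2≤a {a} 3<m))
  where
  [2a+1∸1]/2≡a : (2 * a + 1 ∸ 1) / 2 ≡ a
  [2a+1∸1]/2≡a = trans (cong (_/ 2) (m+n∸n≡m (2 * a) 1)) (⌊2n/2⌋≡n a)

mainTheorem18 : ((k m : ℕ) → m % 2 ≡ 1 → 3 ≤ m →
                   (m ≡ 3 → c (2 ^ k * m + 1) ≡ c (2 ^ k * m) + 2 ^ k * m)
                   × (3 < m → c (2 ^ k * m + 1) + (m ∸ 1) / 2 ≡ c (2 ^ k * m) + 2 ^ k * m))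
                × ((k : ℕ) → 1 ≤ k → c (2 ^ k + 1) + 1 ≡ c (2 ^ k) + 2 ^ k)
mainTheorem18 = oddPart , powerOfTwo
  where
  oddPart : (k m : ℕ) → m % 2 ≡ 1 → 3 ≤ m →
            (m ≡ 3 → c (2 ^ k * m + 1) ≡ c (2 ^ k * m) + 2 ^ k * m)
            × (3 < m → c (2 ^ k * m + 1) + (m ∸ 1) / 2 ≡ c (2 ^ k * m) + 2 ^ k * m)
  oddPart k m m%2≡1 3≤m =
    (λ { refl → trans (sym (+-identityʳ _)) (ΔDeficit-2^k* (s≤s (s≤s z≤n)) ΔDeficit-3 k) }) ,
    (λ 3<m → ΔDeficit-2^k* (≤-trans (s≤s (s≤s z≤n)) 3≤m) (ΔDeficit-odd m%2≡1 3<m) k)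

  powerOfTwo : (k : ℕ) → 1 ≤ k → c (2 ^ k + 1) + 1 ≡ c (2 ^ k) + 2 ^ k
  powerOfTwo (suc k) _ =
    subst (λ n → ΔDeficit n 1) (*-comm (2 ^ k) 2) (ΔDeficit-2^k* (s≤s (s≤s z≤n)) ΔDeficit-2 k)
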